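{- The Tutte polynomial of the broken wheel graph $BW_n$ is symmetric: $T_{BW_n}(x,y)=T_{BW_n}(y,x)$.
   Context: The broken wheel graph $BW_n$ is the multigraph on vertices $0,\dots,n$ with two parallel edges between $0$ and $1$, one edge $0$–$i$ for each $2\le i\le n$, and one edge $i$–$(i+1)$ for $1\le i\le n-1$. $T_{BW_n}$ denotes the Tutte polynomial of this multigraph (equivalently of its graphic matroid, realized by the vectors $x_{2i-1}=e_i-e_{i-1}$, $x_{2i}=e_i$, $i=1,\dots,n$, $e_0:=0$). -}

module Defs where

open import Data.Nat using (ℕ; zero; suc; _∸_; _≟_)
open import Data.Integer using (ℤ; _+_; _-_; _*_; _^_; 1ℤ; 0ℤ)
open import Data.List using (List; []; _∷_; _++_; map; length; upTo; foldr)
open import Data.Product using (_×_; _,_)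
open import Relation.Nullary using (yes; no)

-- A multigraph is given by a list of edges (pairs of vertices in ℕ);
-- parallel edges are distinct list entries.
Edge : Set
Edge = ℕ × ℕ

-- Component labelling: merge the component of v into the component of u.
merge : (ℕ → ℕ) → ℕ → ℕ → (ℕ → ℕ)
merge L u v w with L w ≟ L v
... | yes _ = L u
... | no  _ = L w

-- Size of a spanning forest built greedily (Kruskal) starting from labelling L.
rankFrom : (ℕ → ℕ) → List Edge → ℕ
rankFrom L [] = 0
rankFrom L ((u , v) ∷ es) with L u ≟ L v
... | yes _ = rankFrom L es
... | no  _ = suc (rankFrom (merge L u v) es)

-- Graphic-matroid rank r(A) = |V| - #components of (V, A)
-- (= number of edges of a spanning forest of A).
rank : List Edge → ℕ
rank A = rankFrom (λ w → w) A

subsets : {A : Set} → List A → List (List A)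
subsets [] = [] ∷ []
subsets (e ∷ es) = subsets es ++ map (e ∷_) (subsets es)

sumℤ : List ℤ → ℤ
sumℤ = foldr _+_ 0ℤ

tutte : List Edge → ℤ → ℤ → ℤ
tutte E x y =
  sumℤ (map (λ A → ((x - 1ℤ) ^ (rank E ∸ rank A)) * ((y - 1ℤ) ^ (length A ∸ rank A)))
            (subsets E))

-- Broken wheel BW_n on vertices 0..n: two parallel edges 0–1,
-- edges 0–i for 2 ≤ i ≤ n, and edges i–(i+1) for 1 ≤ i ≤ n-1.
brokenWheel : ℕ → List Edge
brokenWheel n =
  (0 , 1) ∷ (0 , 1) ∷
  (map (λ k → (0 , suc (suc k))) (upTo (n ∸ 1))
   ++ map (λ k → (suc k , suc (suc k))) (upTo (n ∸ 1)))

{-# OPTIONS --safe #-}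
module Submission where

-- Deletion–contraction is applied to the edges in the order brokenWheel lists them: the two
-- parallel edges 0–1, the spokes 0–j, then the path edges i–(i+1).  Kruskal's labelling records
-- the contractions made so far.  During the spokes every vertex is either merged into the hub 0
-- or untouched; along the path every vertex ahead is either in the hub's class or a singleton.
-- Hence the remaining sum depends only on which vertices have been joined to the hub.  Writing
-- a_k, b_k for the fan sums with vertex 1 joined to the hub or not, this gives
-- a_{k+1} = b_k + (1+y) a_k and b_{k+1} = x (b_k + a_k), so T(BW_k) = a_k satisfies
-- T(BW_{k+2}) = (x+y+1) T(BW_{k+1}) − xy T(BW_k), T(BW_0) = 1, T(BW_1) = x + y: all symmetric.

open import Defs
open import Data.Nat as ℕ using (ℕ; zero; suc; _∸_; _≤_; _<_; z≤n; s≤s; _≟_)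
import Data.Nat.Properties as ℕ
open import Data.Integer using (ℤ; _+_; _-_; _*_; _^_; 1ℤ)
open import Data.Integer.Properties
  using (+-assoc; +-identityˡ; +-identityʳ; *-identityʳ; *-distribˡ-+; *-zeroʳ; +-comm; *-comm;
         +-commutativeSemigroup; *-commutativeSemigroup)
open import Algebra.Properties.CommutativeSemigroup +-commutativeSemigroup
  using () renaming (interchange to +-interchange)
open import Algebra.Properties.CommutativeSemigroup *-commutativeSemigroup
  using () renaming (x∙yz≈y∙xz to *-leftSwap)
open import Data.Integer.Tactic.RingSolver using (solve-∀)
open import Data.Bool using (Bool; true; false; T)
open import Data.List using (List; []; _∷_; _++_; map; length; iterate; applyUpTo)
import Data.List.Properties as List
open import Data.Vec using (Vec; []; _∷_; replicate)
open import Data.Vec.Properties using (∷-injectiveˡ; ∷-injectiveʳ)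
open import Data.Product using (_×_; _,_; proj₁; proj₂)
open import Data.Sum using (_⊎_; inj₁; inj₂; [_,_]′)
import Data.Sum as Sum
open import Function using (_∘_; id)
open import Relation.Nullary using (¬_; Dec; does; yes; no; contradiction)
open import Relation.Nullary.Decidable using (dec-true; dec-false)
open import Relation.Binary.PropositionalEquality
open ≡-Reasoning

sumℤ-++ : ∀ xs ys → sumℤ (xs ++ ys) ≡ sumℤ xs + sumℤ ys
sumℤ-++ []       ys = sym (+-identityˡ _)
sumℤ-++ (x ∷ xs) ys = trans (cong (x +_) (sumℤ-++ xs ys)) (sym (+-assoc x _ _))

sumℤ-map-*ˡ : ∀ {A : Set} k (f : A → ℤ) xs →
  sumℤ (map (λ a → k * f a) xs) ≡ k * sumℤ (map f xs)
sumℤ-map-*ˡ k f []       = sym (*-zeroʳ k)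
sumℤ-map-*ˡ k f (x ∷ xs) =
  trans (cong (k * f x +_) (sumℤ-map-*ˡ k f xs)) (sym (*-distribˡ-+ k (f x) _))

spokes : ℕ → ℕ → List Edge
spokes j k = map (0 ,_) (iterate suc j k)

path : ℕ → ℕ → List Edge
path i m = map (λ w → w , suc w) (iterate suc i m)

applyUpTo-iterate : ∀ {A : Set} (g f : ℕ → A) j k → (∀ i → g i ≡ f (j ℕ.+ i)) →
  applyUpTo g k ≡ map f (iterate suc j k)
applyUpTo-iterate g f j zero    g≗f = refl
applyUpTo-iterate g f j (suc k) g≗f = cong₂ _∷_
  (trans (g≗f 0) (cong f (ℕ.+-identityʳ j)))
  (applyUpTo-iterate (g ∘ suc) f (suc j) k (λ i → trans (g≗f (suc i)) (cong f (ℕ.+-suc j i))))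

brokenWheel-spokes-path : ∀ k →
  brokenWheel (suc k) ≡ (0 , 1) ∷ (0 , 1) ∷ spokes 2 k ++ path 1 k
brokenWheel-spokes-path k = cong (λ E → (0 , 1) ∷ (0 , 1) ∷ E) (cong₂ _++_
  (trans (List.map-upTo _ k) (applyUpTo-iterate _ (0 ,_) 2 k (λ _ → refl)))
  (trans (List.map-upTo _ k) (applyUpTo-iterate _ (λ w → w , suc w) 1 k (λ _ → refl))))

Labelling : Set
Labelling = ℕ → ℕ

merge-moved : ∀ L u v {w} → L w ≡ L v → merge L u v w ≡ L u
merge-moved L u v {w} eq with L w ≟ L v
... | yes _   = refl
... | no  neq = contradiction eq neq

merge-unmoved : ∀ L u v {w} → L w ≢ L v → merge L u v w ≡ L w
merge-unmoved L u v {w} neq with L w ≟ L v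
... | yes eq = contradiction eq neq
... | no  _  = refl

rankFrom≤length : ∀ L A → rankFrom L A ≤ length A
rankFrom≤length L []            = z≤n
rankFrom≤length L ((u , v) ∷ A) with L u ≟ L v
... | yes _ = ℕ.m≤n⇒m≤1+n (rankFrom≤length L A)
... | no  _ = s≤s (rankFrom≤length (merge L u v) A)

rankFrom-loop : ∀ L {u v} A → L u ≡ L v → rankFrom L ((u , v) ∷ A) ≡ rankFrom L A
rankFrom-loop L {u} {v} A eq with L u ≟ L v
... | yes _   = refl
... | no  neq = contradiction eq neq

rankFrom-bridge : ∀ L {u v} A → L u ≢ L v →
  rankFrom L ((u , v) ∷ A) ≡ suc (rankFrom (merge L u v) A)
rankFrom-bridge L {u} {v} A neq with L u ≟ L v
... | yes eq = contradiction eq neq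
... | no  _  = refl

Joined : Labelling → ℕ → Set
Joined L w = L w ≡ L 0

Isolated : Labelling → ℕ → Set
Isolated L w = ∀ u → L u ≡ L w → u ≡ w

hubBit : Labelling → ℕ → Bool
hubBit L w = does (L w ≟ L 0)

hubBits : Labelling → ℕ → (m : ℕ) → Vec Bool m
hubBits L j zero    = []
hubBits L j (suc m) = hubBit L j ∷ hubBits L (suc j) m

hubBit-joined : ∀ L {w} → Joined L w → hubBit L w ≡ true
hubBit-joined L {w} = dec-true (L w ≟ L 0)

hubBit-apart : ∀ L {w} → ¬ Joined L w → hubBit L w ≡ false
hubBit-apart L {w} = dec-false (L w ≟ L 0)

hubBit-true⇒joined : ∀ L {w} → hubBit L w ≡ true → Joined L w
hubBit-true⇒joined L {w} eq = ℕ.≡ᵇ⇒≡ (L w) (L 0) (subst T (sym eq) _)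

hubBit-cong : ∀ L' L {w' w} → L' w' ≡ L w → L' 0 ≡ L 0 → hubBit L' w' ≡ hubBit L w
hubBit-cong L' L = cong₂ (λ a b → does (a ≟ b))

isolated⇒apart : ∀ {L w} → Isolated L w → w ≢ 0 → ¬ Joined L w
isolated⇒apart iso w≢0 joined = w≢0 (sym (iso 0 (sym joined)))

isolated-unmoved : ∀ {L u v w} → Isolated L w → w ≢ v → merge L u v w ≡ L w
isolated-unmoved {L} {u} {v} iso w≢v =
  merge-unmoved L u v (λ Lw≡Lv → w≢v (sym (iso v (sym Lw≡Lv))))

isolated-merge : ∀ {L u v w} → Isolated L w → w ≢ u → w ≢ v → Isolated (merge L u v) w
isolated-merge {L} {u} {v} {w} iso w≢u w≢v x eq with L x ≟ L v
... | yes _ = contradiction (sym (iso u (trans eq (isolated-unmoved iso w≢v)))) w≢u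
... | no  _ = iso x (trans eq (isolated-unmoved iso w≢v))

HubOrSelf : Labelling → Set
HubOrSelf L = L 0 ≡ 0 × (∀ w → L w ≡ 0 ⊎ L w ≡ w)

Untouched : ℕ → Labelling → Set
Untouched j L = ∀ w → j ≤ w → L w ≡ w

untouched-suc : ∀ {j L} → Untouched j L → Untouched (suc j) L
untouched-suc fresh w j<w = fresh w (ℕ.<⇒≤ j<w)

contractSpoke : Bool → Labelling → ℕ → Labelling
contractSpoke false L j = L
contractSpoke true  L j = merge L 0 j

contractSpokes : ∀ {k} → Labelling → ℕ → Vec Bool k → Labelling
contractSpokes L j []      = L
contractSpokes L j (b ∷ S) = contractSpokes (contractSpoke b L j) (suc j) S

module _ {L : Labelling} {j : ℕ} (hub : HubOrSelf L) (fresh : Untouched (suc j) L) where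

  spoke-bridge : L 0 ≢ L (suc j)
  spoke-bridge eq = ℕ.0≢1+n (trans (sym (proj₁ hub)) (trans eq (fresh (suc j) ℕ.≤-refl)))

  merge-spoke-other : ∀ {w} → w ≢ suc j → merge L 0 (suc j) w ≡ L w
  merge-spoke-other {w} w≢j =
    merge-unmoved L 0 (suc j) (λ eq → [ zero≢ eq , self≢ eq ]′ (proj₂ hub w))
    where
    zero≢ : L w ≡ L (suc j) → L w ≢ 0
    zero≢ eq Lw≡0 = spoke-bridge (trans (proj₁ hub) (trans (sym Lw≡0) eq))
    self≢ : L w ≡ L (suc j) → L w ≢ w
    self≢ eq Lw≡w = w≢j (trans (sym Lw≡w) (trans eq (fresh (suc j) ℕ.≤-refl)))

  contractSpoke-below : ∀ b {w} → w ≤ j → contractSpoke b L (suc j) w ≡ L w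
  contractSpoke-below false w≤j = refl
  contractSpoke-below true  w≤j = merge-spoke-other (ℕ.<⇒≢ (s≤s w≤j))

  contractSpoke-hubOrSelf : ∀ b → HubOrSelf (contractSpoke b L (suc j))
  contractSpoke-hubOrSelf false = hub
  contractSpoke-hubOrSelf true  = trans (contractSpoke-below true z≤n) (proj₁ hub) , labels
    where
    labels : ∀ w → merge L 0 (suc j) w ≡ 0 ⊎ merge L 0 (suc j) w ≡ w
    labels w with w ≟ suc j
    ... | yes refl = inj₁ (trans (merge-moved L 0 (suc j) refl) (proj₁ hub))
    ... | no  w≢j  =
      Sum.map (trans (merge-spoke-other w≢j)) (trans (merge-spoke-other w≢j)) (proj₂ hub w)

  contractSpoke-untouched : ∀ b → Untouched (suc (suc j)) (contractSpoke b L (suc j))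
  contractSpoke-untouched false = untouched-suc fresh
  contractSpoke-untouched true w j<w = trans (merge-spoke-other (ℕ.>⇒≢ j<w)) (fresh w (ℕ.<⇒≤ j<w))

  contractSpoke-hubBit : ∀ b → hubBit (contractSpoke b L (suc j)) (suc j) ≡ b
  contractSpoke-hubBit false = hubBit-apart L (spoke-bridge ∘ sym)
  contractSpoke-hubBit true  =
    hubBit-joined (merge L 0 (suc j))
      (trans (merge-moved L 0 (suc j) refl) (sym (contractSpoke-below true z≤n)))

contractSpokes-hubOrSelf : ∀ {k L j} → HubOrSelf L → Untouched (suc j) L →
  (S : Vec Bool k) → HubOrSelf (contractSpokes L (suc j) S)
contractSpokes-hubOrSelf hub fresh []      = hub
contractSpokes-hubOrSelf hub fresh (b ∷ S) = contractSpokes-hubOrSelf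
  (contractSpoke-hubOrSelf hub fresh b) (contractSpoke-untouched hub fresh b) S

contractSpokes-below : ∀ {k L j w} → HubOrSelf L → Untouched (suc j) L →
  (S : Vec Bool k) → w ≤ j → contractSpokes L (suc j) S w ≡ L w
contractSpokes-below hub fresh []      w≤j = refl
contractSpokes-below hub fresh (b ∷ S) w≤j = trans
  (contractSpokes-below (contractSpoke-hubOrSelf hub fresh b) (contractSpoke-untouched hub fresh b) S
    (ℕ.m≤n⇒m≤1+n w≤j))
  (contractSpoke-below hub fresh b w≤j)

contractSpokes-hubBit-below : ∀ {k L j w} → HubOrSelf L → Untouched (suc j) L →
  (S : Vec Bool k) → w ≤ j → hubBit (contractSpokes L (suc j) S) w ≡ hubBit L w
contractSpokes-hubBit-below {L = L} {j} hub fresh S w≤j =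
  hubBit-cong (contractSpokes L (suc j) S) L
    (contractSpokes-below hub fresh S w≤j) (contractSpokes-below hub fresh S z≤n)

contractSpokes-hubBits : ∀ {k L j} → HubOrSelf L → Untouched (suc j) L →
  (S : Vec Bool k) → hubBits (contractSpokes L (suc j) S) (suc j) k ≡ S
contractSpokes-hubBits hub fresh []      = refl
contractSpokes-hubBits hub fresh (b ∷ S) = cong₂ _∷_
  (trans (contractSpokes-hubBit-below hub' fresh' S ℕ.≤-refl) (contractSpoke-hubBit hub fresh b))
  (contractSpokes-hubBits hub' fresh' S)
  where
  hub'   = contractSpoke-hubOrSelf hub fresh b
  fresh' = contractSpoke-untouched hub fresh b

JoinedOrIsolatedAbove : ℕ → Labelling → Set
JoinedOrIsolatedAbove i L = ∀ w → i < w → Joined L w ⊎ Isolated L w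

hubOrSelf⇒joinedOrIsolated : ∀ {L} i → HubOrSelf L → JoinedOrIsolatedAbove i L
hubOrSelf⇒joinedOrIsolated {L} i (L0≡0 , labels) w i<w with labels w
... | inj₁ Lw≡0 = inj₁ (trans Lw≡0 (sym L0≡0))
... | inj₂ Lw≡w = inj₂ isolated
  where
  isolated : Isolated L w
  isolated u Lu≡Lw with labels u
  ... | inj₁ Lu≡0 = contradiction (trans (sym Lw≡w) (trans (sym Lu≡Lw) Lu≡0)) (ℕ.m<n⇒n≢0 i<w)
  ... | inj₂ Lu≡u = trans (sym Lu≡u) (trans Lu≡Lw Lw≡w)

StatusAgreesAbove : ℕ → Labelling → Labelling → Set
StatusAgreesAbove i L' L =
  ∀ w → i < w → (Joined L' w × Joined L w) ⊎ (Isolated L' w × Isolated L w)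

agrees⇒joinedOrIsolated : ∀ {i L' L} → StatusAgreesAbove i L' L → JoinedOrIsolatedAbove i L'
agrees⇒joinedOrIsolated agree w i<w = Sum.map proj₁ proj₁ (agree w i<w)

agrees⇒hubBits : ∀ {i L' L} → StatusAgreesAbove i L' L →
  ∀ {j} m → i < j → hubBits L' j m ≡ hubBits L j m
agrees⇒hubBits             agree zero    i<j = refl
agrees⇒hubBits {i} {L'} {L} agree {j} (suc m) i<j =
  cong₂ _∷_ (sameBit (agree j i<j)) (agrees⇒hubBits agree m (ℕ.m<n⇒m<1+n i<j))
  where
  j≢0 = ℕ.m<n⇒n≢0 i<j
  sameBit : (Joined L' j × Joined L j) ⊎ (Isolated L' j × Isolated L j) → hubBit L' j ≡ hubBit L j
  sameBit (inj₁ (joined' , joined)) = trans (hubBit-joined L' joined') (sym (hubBit-joined L joined))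
  sameBit (inj₂ (iso' , iso)) =
    trans (hubBit-apart L' (isolated⇒apart iso' j≢0)) (sym (hubBit-apart L (isolated⇒apart iso j≢0)))

module _ {L : Labelling} {i : ℕ} (inv : JoinedOrIsolatedAbove i L) where

  contract-into-hub : Joined L (suc i) →
    Joined (merge L i (suc i)) (suc i) × StatusAgreesAbove (suc i) (merge L i (suc i)) L
  contract-into-hub next∙ = trans next≡i (sym hub≡i) , agree
    where
    hub≡i : merge L i (suc i) 0 ≡ L i
    hub≡i = merge-moved L i (suc i) (sym next∙)
    next≡i : merge L i (suc i) (suc i) ≡ L i
    next≡i = merge-moved L i (suc i) refl
    agree : StatusAgreesAbove (suc i) (merge L i (suc i)) L
    agree w next<w with inv w (ℕ.<⇒≤ next<w)
    ... | inj₁ w∙  = inj₁ (trans (merge-moved L i (suc i) (trans w∙ (sym next∙))) (sym hub≡i) , w∙)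
    ... | inj₂ iso = inj₂ (isolated-merge iso (ℕ.>⇒≢ (ℕ.<⇒≤ next<w)) (ℕ.>⇒≢ next<w) , iso)

  contract-isolated : Isolated L (suc i) →
    (hubBit (merge L i (suc i)) (suc i) ≡ hubBit L i) × StatusAgreesAbove (suc i) (merge L i (suc i)) L
  contract-isolated next-iso =
    hubBit-cong (merge L i (suc i)) L (merge-moved L i (suc i) refl) hub≡0 , agree
    where
    hub≡0 : merge L i (suc i) 0 ≡ L 0
    hub≡0 = merge-unmoved L i (suc i) (λ eq → ℕ.0≢1+n (next-iso 0 eq))
    agree : StatusAgreesAbove (suc i) (merge L i (suc i)) L
    agree w next<w with inv w (ℕ.<⇒≤ next<w)
    ... | inj₁ w∙  = inj₁ (trans w≡w (trans w∙ (sym hub≡0)) , w∙)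
      where
      w≡w : merge L i (suc i) w ≡ L w
      w≡w = merge-unmoved L i (suc i) (λ eq → ℕ.>⇒≢ next<w (next-iso w eq))
    ... | inj₂ iso = inj₂ (isolated-merge iso (ℕ.>⇒≢ (ℕ.<⇒≤ next<w)) (ℕ.>⇒≢ next<w) , iso)

choiceSum : (k : ℕ) → (Vec Bool k → ℕ → ℤ) → ℕ → ℤ
choiceSum zero    K c = K [] c
choiceSum (suc k) K c =
  choiceSum k (λ S → K (false ∷ S)) c + choiceSum k (λ S → K (true ∷ S)) (c ∸ 1)

choiceSum-cong : ∀ k {K K'} c → (∀ S c' → K S c' ≡ K' S c') → choiceSum k K c ≡ choiceSum k K' c
choiceSum-cong zero    c K≗K' = K≗K' [] c
choiceSum-cong (suc k) c K≗K' = cong₂ _+_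
  (choiceSum-cong k c (λ S → K≗K' (false ∷ S))) (choiceSum-cong k (c ∸ 1) (λ S → K≗K' (true ∷ S)))

choiceSum-+ : ∀ k K₁ K₂ c →
  choiceSum k (λ S c' → K₁ S c' + K₂ S c') c ≡ choiceSum k K₁ c + choiceSum k K₂ c
choiceSum-+ zero    K₁ K₂ c = refl
choiceSum-+ (suc k) K₁ K₂ c = trans
  (cong₂ _+_ (choiceSum-+ k (λ S → K₁ (false ∷ S)) (λ S → K₂ (false ∷ S)) c)
             (choiceSum-+ k (λ S → K₁ (true ∷ S)) (λ S → K₂ (true ∷ S)) (c ∸ 1)))
  (+-interchange (choiceSum k (λ S → K₁ (false ∷ S)) c) (choiceSum k (λ S → K₂ (false ∷ S)) c)
                 (choiceSum k (λ S → K₁ (true ∷ S)) (c ∸ 1)) _)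

choiceSum-*ˡ : ∀ k a K c → choiceSum k (λ S c' → a * K S c') c ≡ a * choiceSum k K c
choiceSum-*ˡ zero    a K c = refl
choiceSum-*ˡ (suc k) a K c = trans
  (cong₂ _+_ (choiceSum-*ˡ k a (λ S → K (false ∷ S)) c)
             (choiceSum-*ˡ k a (λ S → K (true ∷ S)) (c ∸ 1)))
  (sym (*-distribˡ-+ a _ _))

choiceSum-∸1 : ∀ k K c → choiceSum k (λ S c' → K S (c' ∸ 1)) c ≡ choiceSum k K (c ∸ 1)
choiceSum-∸1 zero    K c = refl
choiceSum-∸1 (suc k) K c =
  cong₂ _+_ (choiceSum-∸1 k (λ S → K (false ∷ S)) c)
            (choiceSum-∸1 k (λ S → K (true ∷ S)) (c ∸ 1))

module TutteSum (X Y : ℤ) where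

  -- The subset expansion over the partition L, with c standing for the rank of the whole graph.
  term : Labelling → ℕ → List Edge → ℤ
  term L c A = X ^ (c ∸ rankFrom L A) * Y ^ (length A ∸ rankFrom L A)

  tutteSum : Labelling → List Edge → ℕ → ℤ
  tutteSum L E c = sumℤ (map (term L c) (subsets E))

  tutteSum-[] : ∀ L c → tutteSum L [] c ≡ X ^ c
  tutteSum-[] L c = trans (+-identityʳ _) (*-identityʳ _)

  tutteSum-∷ : ∀ L e E c →
    tutteSum L (e ∷ E) c ≡ tutteSum L E c + sumℤ (map (λ A → term L c (e ∷ A)) (subsets E))
  tutteSum-∷ L e E c = begin
    sumℤ (map (term L c) (subsets E ++ map (e ∷_) (subsets E)))
      ≡⟨ cong sumℤ (List.map-++ (term L c) (subsets E) _) ⟩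
    sumℤ (map (term L c) (subsets E) ++ map (term L c) (map (e ∷_) (subsets E)))
      ≡⟨ sumℤ-++ (map (term L c) (subsets E)) _ ⟩
    tutteSum L E c + sumℤ (map (term L c) (map (e ∷_) (subsets E)))
      ≡⟨ cong (λ es → tutteSum L E c + sumℤ es) (sym (List.map-∘ (subsets E))) ⟩
    tutteSum L E c + sumℤ (map (λ A → term L c (e ∷ A)) (subsets E)) ∎

  tutteSum-loop : ∀ L {u v} E c → L u ≡ L v →
    tutteSum L ((u , v) ∷ E) c ≡ tutteSum L E c + Y * tutteSum L E c
  tutteSum-loop L {u} {v} E c loop = begin
    tutteSum L ((u , v) ∷ E) c
      ≡⟨ tutteSum-∷ L (u , v) E c ⟩
    tutteSum L E c + sumℤ (map (λ A → term L c ((u , v) ∷ A)) (subsets E))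
      ≡⟨ cong (tutteSum L E c +_) (cong sumℤ (List.map-cong extraNullity (subsets E))) ⟩
    tutteSum L E c + sumℤ (map (λ A → Y * term L c A) (subsets E))
      ≡⟨ cong (tutteSum L E c +_) (sumℤ-map-*ˡ Y (term L c) (subsets E)) ⟩
    tutteSum L E c + Y * tutteSum L E c ∎
    where
    extraNullity : ∀ A → term L c ((u , v) ∷ A) ≡ Y * term L c A
    extraNullity A rewrite rankFrom-loop L A loop | ℕ.+-∸-assoc 1 (rankFrom≤length L A) =
      *-leftSwap (X ^ (c ∸ rankFrom L A)) Y (Y ^ (length A ∸ rankFrom L A))

  tutteSum-bridge : ∀ L {u v} E c → L u ≢ L v →
    tutteSum L ((u , v) ∷ E) c ≡ tutteSum L E c + tutteSum (merge L u v) E (c ∸ 1)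
  tutteSum-bridge L {u} {v} E c bridge = trans (tutteSum-∷ L (u , v) E c)
    (cong (tutteSum L E c +_) (cong sumℤ (List.map-cong contracted (subsets E))))
    where
    contracted : ∀ A → term L c ((u , v) ∷ A) ≡ term (merge L u v) (c ∸ 1) A
    contracted A rewrite rankFrom-bridge L A bridge | ℕ.∸-+-assoc c 1 (rankFrom (merge L u v) A) = refl


  -- b says whether the current path vertex lies in the hub's class, S the same for the vertices ahead.
  pathSum : ∀ {m} → Vec Bool m → Bool → ℕ → ℤ
  pathSum []           b     c = X ^ c
  pathSum (true  ∷ S) true  c = pathSum S true c + Y * pathSum S true c
  pathSum (true  ∷ S) false c = pathSum S true c + pathSum S true (c ∸ 1)
  pathSum (false ∷ S) b     c = pathSum S false c + pathSum S b (c ∸ 1)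

  tutteSum-path : ∀ m {i L} c → JoinedOrIsolatedAbove i L →
    tutteSum L (path i m) c ≡ pathSum (hubBits L (suc i) m) (hubBit L i) c
  tutteSum-path zero    {i} {L} c inv = tutteSum-[] L c
  tutteSum-path (suc m) {i} {L} c inv = byStatus (L (suc i) ≟ L 0) (L i ≟ L 0)
    where
    E  = path (suc i) m
    S  = hubBits L (suc (suc i)) m
    L' = merge L i (suc i)

    deleted : ∀ {b} → hubBit L (suc i) ≡ b → tutteSum L E c ≡ pathSum S b c
    deleted refl = tutteSum-path m c (λ w next<w → inv w (ℕ.<⇒≤ next<w))

    contracted : ∀ {b} → StatusAgreesAbove (suc i) L' L → hubBit L' (suc i) ≡ b →
      tutteSum L' E (c ∸ 1) ≡ pathSum S b (c ∸ 1)
    contracted agree refl = trans (tutteSum-path m (c ∸ 1) (agrees⇒joinedOrIsolated agree))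
      (cong (λ S' → pathSum S' (hubBit L' (suc i)) (c ∸ 1)) (agrees⇒hubBits agree m ℕ.≤-refl))

    byStatus : Dec (Joined L (suc i)) → Dec (Joined L i) →
      tutteSum L ((i , suc i) ∷ E) c ≡ pathSum (hubBit L (suc i) ∷ S) (hubBit L i) c
    byStatus (yes next∙) (yes this∙) rewrite hubBit-joined L next∙ | hubBit-joined L this∙ =
      trans (tutteSum-loop L E c (trans this∙ (sym next∙)))
            (cong (λ t → t + Y * t) (deleted (hubBit-joined L next∙)))
    byStatus (yes next∙) (no this∘) rewrite hubBit-joined L next∙ | hubBit-apart L this∘ =
      trans (tutteSum-bridge L E c (λ eq → this∘ (trans eq next∙)))
            (cong₂ _+_ (deleted (hubBit-joined L next∙)) (contracted agree (hubBit-joined L' next∙')))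
      where
      next∙' = proj₁ (contract-into-hub inv next∙)
      agree  = proj₂ (contract-into-hub inv next∙)
    byStatus (no next∘) _ rewrite hubBit-apart L next∘ =
      trans (tutteSum-bridge L E c (λ eq → ℕ.<-irrefl (next-iso i eq) (ℕ.n<1+n i)))
            (cong₂ _+_ (deleted (hubBit-apart L next∘)) (contracted agree bit))
      where
      next-iso : Isolated L (suc i)
      next-iso = [ (λ next∙ → contradiction next∙ next∘) , id ]′ (inv (suc i) (ℕ.n<1+n i))
      bit   = proj₁ (contract-isolated inv next-iso)
      agree = proj₂ (contract-isolated inv next-iso)

  tutteSum-spokes : ∀ k {j L} A c → HubOrSelf L → Untouched (suc j) L →
    tutteSum L (spokes (suc j) k ++ A) c ≡ choiceSum k (λ S → tutteSum (contractSpokes L (suc j) S) A) c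
  tutteSum-spokes zero    A c hub fresh = refl
  tutteSum-spokes (suc k) {j} {L} A c hub fresh =
    trans (tutteSum-bridge L (spokes (suc (suc j)) k ++ A) c (spoke-bridge hub fresh))
          (cong₂ _+_ (afterSpoke false c) (afterSpoke true (c ∸ 1)))
    where
    afterSpoke : ∀ b c' → tutteSum (contractSpoke b L (suc j)) (spokes (suc (suc j)) k ++ A) c' ≡
                          choiceSum k (λ S → tutteSum (contractSpokes L (suc j) (b ∷ S)) A) c'
    afterSpoke b c' =
      tutteSum-spokes k A c' (contractSpoke-hubOrSelf hub fresh b) (contractSpoke-untouched hub fresh b)

  -- The fan with spokes 0–2, …, 0–(k+1) and path 1–2–…–(k+1), vertex 1 being in the hub's class iff b.
  fanSum : ℕ → Bool → ℕ → ℤ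
  fanSum k b = choiceSum k (λ S → pathSum S b)

  tutteSum-fan : ∀ k {L} c → HubOrSelf L → Untouched 2 L →
    tutteSum L (spokes 2 k ++ path 1 k) c ≡ fanSum k (hubBit L 1) c
  tutteSum-fan k {L} c hub fresh =
    trans (tutteSum-spokes k (path 1 k) c hub fresh) (choiceSum-cong k c alongPath)
    where
    alongPath : ∀ S c' → tutteSum (contractSpokes L 2 S) (path 1 k) c' ≡ pathSum S (hubBit L 1) c'
    alongPath S c' = trans
      (tutteSum-path k c' (hubOrSelf⇒joinedOrIsolated 1 (contractSpokes-hubOrSelf hub fresh S)))
      (cong₂ (λ S' b → pathSum S' b c')
             (contractSpokes-hubBits hub fresh S) (contractSpokes-hubBit-below hub fresh S ℕ.≤-refl))

  fanSum-suc-true : ∀ k c →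
    fanSum (suc k) true c ≡ fanSum k false c + fanSum k true (c ∸ 1)
                              + (fanSum k true (c ∸ 1) + Y * fanSum k true (c ∸ 1))
  fanSum-suc-true k c = cong₂ _+_
    (trans (choiceSum-+ k (λ S → pathSum S false) (λ S c' → pathSum S true (c' ∸ 1)) c)
           (cong (fanSum k false c +_) (choiceSum-∸1 k (λ S → pathSum S true) c)))
    (trans (choiceSum-+ k (λ S → pathSum S true) (λ S c' → Y * pathSum S true c') (c ∸ 1))
           (cong (fanSum k true (c ∸ 1) +_) (choiceSum-*ˡ k Y (λ S → pathSum S true) (c ∸ 1))))

  fanSum-suc-false : ∀ k c →
    fanSum (suc k) false c ≡ fanSum k false c + fanSum k false (c ∸ 1)
                               + (fanSum k true (c ∸ 1) + fanSum k true (c ∸ 1 ∸ 1))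
  fanSum-suc-false k c = cong₂ _+_
    (trans (choiceSum-+ k (λ S → pathSum S false) (λ S c' → pathSum S false (c' ∸ 1)) c)
           (cong (fanSum k false c +_) (choiceSum-∸1 k (λ S → pathSum S false) c)))
    (trans (choiceSum-+ k (λ S → pathSum S true) (λ S c' → pathSum S true (c' ∸ 1)) (c ∸ 1))
           (cong (fanSum k true (c ∸ 1) +_) (choiceSum-∸1 k (λ S → pathSum S true) (c ∸ 1))))

  fanRank : ℕ → Bool → ℕ
  fanRank k true  = k
  fanRank k false = suc k

  fanSum-beyond-rank : ∀ k b {c} → fanRank k b ≤ c → fanSum k b (suc c) ≡ X * fanSum k b c
  fanSum-beyond-rank zero    b     _ = refl
  fanSum-beyond-rank (suc k) true  {suc c} (s≤s k≤c) = begin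
    fanSum (suc k) true (suc (suc c))
      ≡⟨ fanSum-suc-true k (suc (suc c)) ⟩
    fanSum k false (suc (suc c)) + t₁ + (t₁ + Y * t₁)
      ≡⟨ cong₂ (λ a t → a + t + (t + Y * t))
               (fanSum-beyond-rank k false (s≤s k≤c)) (fanSum-beyond-rank k true k≤c) ⟩
    X * fanSum k false (suc c) + X * t₀ + (X * t₀ + Y * (X * t₀))
      ≡⟨ factor X Y (fanSum k false (suc c)) t₀ ⟩
    X * (fanSum k false (suc c) + t₀ + (t₀ + Y * t₀))
      ≡⟨ cong (X *_) (sym (fanSum-suc-true k (suc c))) ⟩
    X * fanSum (suc k) true (suc c) ∎
    where
    t₀ = fanSum k true c
    t₁ = fanSum k true (suc c)
    factor : ∀ x y a t → x * a + x * t + (x * t + y * (x * t)) ≡ x * (a + t + (t + y * t))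
    factor = solve-∀
  fanSum-beyond-rank (suc k) false {suc (suc c)} (s≤s (s≤s k≤c)) = begin
    fanSum (suc k) false (suc (suc (suc c)))
      ≡⟨ fanSum-suc-false k (suc (suc (suc c))) ⟩
    fanSum k false (3 ℕ.+ c) + fanSum k false (2 ℕ.+ c) + (fanSum k true (2 ℕ.+ c) + fanSum k true (suc c))
      ≡⟨ cong₂ _+_ (cong₂ _+_ (fanSum-beyond-rank k false (s≤s k≤1+c)) (fanSum-beyond-rank k false (s≤s k≤c)))
                   (cong₂ _+_ (fanSum-beyond-rank k true k≤1+c) (fanSum-beyond-rank k true k≤c)) ⟩
    X * fanSum k false (2 ℕ.+ c) + X * fanSum k false (suc c) + (X * fanSum k true (suc c) + X * fanSum k true c)
      ≡⟨ factor X _ _ (fanSum k true (suc c)) (fanSum k true c) ⟩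
    X * (fanSum k false (2 ℕ.+ c) + fanSum k false (suc c) + (fanSum k true (suc c) + fanSum k true c))
      ≡⟨ cong (X *_) (sym (fanSum-suc-false k (suc (suc c)))) ⟩
    X * fanSum (suc k) false (suc (suc c)) ∎
    where
    k≤1+c = ℕ.m≤n⇒m≤1+n k≤c
    factor : ∀ x a b c d → x * a + x * b + (x * c + x * d) ≡ x * (a + b + (c + d))
    factor = solve-∀

identity-hubOrSelf : HubOrSelf id
identity-hubOrSelf = refl , λ _ → inj₂ refl

identity-untouched : ∀ j → Untouched j id
identity-untouched j _ _ = refl

edge01-hubOrSelf : HubOrSelf (merge id 0 1)
edge01-hubOrSelf = contractSpoke-hubOrSelf identity-hubOrSelf (identity-untouched 1) true

edge01-untouched : Untouched 2 (merge id 0 1)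
edge01-untouched = contractSpoke-untouched identity-hubOrSelf (identity-untouched 1) true

rankFrom-spokes : ∀ k {j L} A → HubOrSelf L → Untouched (suc j) L →
  rankFrom L (spokes (suc j) k ++ A) ≡ k ℕ.+ rankFrom (contractSpokes L (suc j) (replicate k true)) A
rankFrom-spokes zero    A hub fresh = refl
rankFrom-spokes (suc k) {j} {L} A hub fresh =
  trans (rankFrom-bridge L (spokes (suc (suc j)) k ++ A) (spoke-bridge hub fresh))
        (cong suc (rankFrom-spokes k A (contractSpoke-hubOrSelf hub fresh true)
                                       (contractSpoke-untouched hub fresh true)))

rankFrom-path-joined : ∀ m {i} L → hubBit L i ≡ true → hubBits L (suc i) m ≡ replicate m true →
  rankFrom L (path i m) ≡ 0
rankFrom-path-joined zero    L _     _     = refl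
rankFrom-path-joined (suc m) {i} L this∙ rest∙ = trans
  (rankFrom-loop L (path (suc i) m)
    (trans (hubBit-true⇒joined L this∙) (sym (hubBit-true⇒joined L next∙))))
  (rankFrom-path-joined m L next∙ (∷-injectiveʳ rest∙))
  where
  next∙ = ∷-injectiveˡ rest∙

rank-brokenWheel : ∀ k → rank (brokenWheel (suc k)) ≡ suc k
rank-brokenWheel k = begin
  rank (brokenWheel (suc k))
    ≡⟨ cong rank (brokenWheel-spokes-path k) ⟩
  rankFrom id ((0 , 1) ∷ (0 , 1) ∷ F)
    ≡⟨ rankFrom-bridge id {0} {1} ((0 , 1) ∷ F) (λ ()) ⟩
  suc (rankFrom (merge id 0 1) ((0 , 1) ∷ F))
    ≡⟨ cong suc (rankFrom-loop (merge id 0 1) {0} {1} F refl) ⟩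
  suc (rankFrom (merge id 0 1) F)
    ≡⟨ cong suc (rankFrom-spokes k (path 1 k) edge01-hubOrSelf edge01-untouched) ⟩
  suc (k ℕ.+ rankFrom contracted (path 1 k))
    ≡⟨ cong (λ r → suc (k ℕ.+ r)) (rankFrom-path-joined k contracted
         (contractSpokes-hubBit-below edge01-hubOrSelf edge01-untouched (replicate k true) ℕ.≤-refl)
         (contractSpokes-hubBits edge01-hubOrSelf edge01-untouched (replicate k true))) ⟩
  suc (k ℕ.+ 0)
    ≡⟨ cong suc (ℕ.+-identityʳ k) ⟩
  suc k ∎
  where
  F = spokes 2 k ++ path 1 k
  contracted = contractSpokes (merge id 0 1) 2 (replicate k true)

linearRecurrence : (s t u₀ u₁ : ℤ) → ℕ → ℤ
linearRecurrence s t u₀ u₁ zero          = u₀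
linearRecurrence s t u₀ u₁ (suc zero)    = u₁
linearRecurrence s t u₀ u₁ (suc (suc k)) =
  s * linearRecurrence s t u₀ u₁ (suc k) - t * linearRecurrence s t u₀ u₁ k

linearRecurrence-unique : ∀ {s t u₀ u₁} (f : ℕ → ℤ) → f 0 ≡ u₀ → f 1 ≡ u₁ →
  (∀ k → f (suc (suc k)) ≡ s * f (suc k) - t * f k) → ∀ k → f k ≡ linearRecurrence s t u₀ u₁ k
linearRecurrence-unique f f₀ f₁ step zero          = f₀
linearRecurrence-unique f f₀ f₁ step (suc zero)    = f₁
linearRecurrence-unique {s} {t} f f₀ f₁ step (suc (suc k)) = trans (step k)
  (cong₂ (λ a b → s * a - t * b)
         (linearRecurrence-unique f f₀ f₁ step (suc k)) (linearRecurrence-unique f f₀ f₁ step k))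

module BrokenWheel (x y : ℤ) where
  open TutteSum (x - 1ℤ) (y - 1ℤ)

  tutteSum-brokenWheel : ∀ k c → tutteSum id (brokenWheel (suc k)) c ≡ fanSum (suc k) true c
  tutteSum-brokenWheel k c = begin
    tutteSum id (brokenWheel (suc k)) c
      ≡⟨ cong (λ E → tutteSum id E c) (brokenWheel-spokes-path k) ⟩
    tutteSum id ((0 , 1) ∷ (0 , 1) ∷ F) c
      ≡⟨ tutteSum-bridge id {0} {1} ((0 , 1) ∷ F) c (λ ()) ⟩
    tutteSum id ((0 , 1) ∷ F) c + tutteSum (merge id 0 1) ((0 , 1) ∷ F) (c ∸ 1)
      ≡⟨ cong₂ _+_ (tutteSum-bridge id {0} {1} F c (λ ()))
                   (tutteSum-loop (merge id 0 1) {0} {1} F (c ∸ 1) refl) ⟩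
    tutteSum id F c + t + (t + (y - 1ℤ) * t)
      ≡⟨ cong₂ (λ d e → d + e + (e + (y - 1ℤ) * e))
               (tutteSum-fan k c identity-hubOrSelf (identity-untouched 2))
               (tutteSum-fan k (c ∸ 1) edge01-hubOrSelf edge01-untouched) ⟩
    fanSum k false c + fanSum k true (c ∸ 1) + (fanSum k true (c ∸ 1) + (y - 1ℤ) * fanSum k true (c ∸ 1))
      ≡⟨ sym (fanSum-suc-true k c) ⟩
    fanSum (suc k) true c ∎
    where
    F = spokes 2 k ++ path 1 k
    t = tutteSum (merge id 0 1) F (c ∸ 1)

  fanJoined : ℕ → ℤ
  fanJoined k = fanSum k true k

  fanApart : ℕ → ℤ
  fanApart k = fanSum k false (suc k)

  fanJoined-suc : ∀ k → fanJoined (suc k) ≡ fanApart k + (1ℤ + y) * fanJoined k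
  fanJoined-suc k = trans (fanSum-suc-true k (suc k)) (collect y (fanApart k) (fanJoined k))
    where
    collect : ∀ y a t → a + t + (t + (y - 1ℤ) * t) ≡ a + (1ℤ + y) * t
    collect = solve-∀

  fanApart-suc : ∀ k → fanApart (suc k) ≡ x * (fanApart k + fanJoined k)
  fanApart-suc k = begin
    fanSum (suc k) false (suc (suc k))
      ≡⟨ fanSum-suc-false k (suc (suc k)) ⟩
    fanSum k false (suc (suc k)) + fanApart k + (fanSum k true (suc k) + fanJoined k)
      ≡⟨ cong₂ (λ a t → a + fanApart k + (t + fanJoined k))
               (fanSum-beyond-rank k false ℕ.≤-refl) (fanSum-beyond-rank k true ℕ.≤-refl) ⟩
    (x - 1ℤ) * fanApart k + fanApart k + ((x - 1ℤ) * fanJoined k + fanJoined k)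
      ≡⟨ collect x (fanApart k) (fanJoined k) ⟩
    x * (fanApart k + fanJoined k) ∎
    where
    collect : ∀ x a t → (x - 1ℤ) * a + a + ((x - 1ℤ) * t + t) ≡ x * (a + t)
    collect = solve-∀

  fanJoined-one : fanJoined 1 ≡ x + y
  fanJoined-one = trans (fanJoined-suc 0) (collect x y)
    where
    collect : ∀ x y → (x - 1ℤ) * 1ℤ + (1ℤ + y) * 1ℤ ≡ x + y
    collect = solve-∀

  fanJoined-recurrence : ∀ k →
    fanJoined (suc (suc k)) ≡ (x + y + 1ℤ) * fanJoined (suc k) - x * y * fanJoined k
  fanJoined-recurrence k = begin
    fanJoined (suc (suc k))
      ≡⟨ fanJoined-suc (suc k) ⟩
    fanApart (suc k) + (1ℤ + y) * fanJoined (suc k)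
      ≡⟨ cong₂ (λ b a → b + (1ℤ + y) * a) (fanApart-suc k) (fanJoined-suc k) ⟩
    x * (fanApart k + fanJoined k) + (1ℤ + y) * (fanApart k + (1ℤ + y) * fanJoined k)
      ≡⟨ eliminate x y (fanApart k) (fanJoined k) ⟩
    (x + y + 1ℤ) * (fanApart k + (1ℤ + y) * fanJoined k) - x * y * fanJoined k
      ≡⟨ cong (λ a → (x + y + 1ℤ) * a - x * y * fanJoined k) (sym (fanJoined-suc k)) ⟩
    (x + y + 1ℤ) * fanJoined (suc k) - x * y * fanJoined k ∎
    where
    eliminate : ∀ x y b a →
      x * (b + a) + (1ℤ + y) * (b + (1ℤ + y) * a) ≡ (x + y + 1ℤ) * (b + (1ℤ + y) * a) - x * y * a
    eliminate = solve-∀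

  tutte-brokenWheel : ∀ k →
    tutte (brokenWheel (suc k)) x y ≡ linearRecurrence (x + y + 1ℤ) (x * y) 1ℤ (x + y) (suc k)
  tutte-brokenWheel k = begin
    tutte (brokenWheel (suc k)) x y
      ≡⟨⟩
    tutteSum id (brokenWheel (suc k)) (rank (brokenWheel (suc k)))
      ≡⟨ cong (tutteSum id (brokenWheel (suc k))) (rank-brokenWheel k) ⟩
    tutteSum id (brokenWheel (suc k)) (suc k)
      ≡⟨ tutteSum-brokenWheel k (suc k) ⟩
    fanJoined (suc k)
      ≡⟨ linearRecurrence-unique fanJoined refl fanJoined-one fanJoined-recurrence (suc k) ⟩
    linearRecurrence (x + y + 1ℤ) (x * y) 1ℤ (x + y) (suc k) ∎

proposition4 : (n : ℕ) → 1 ≤ n → (x y : ℤ) →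
    tutte (brokenWheel n) x y ≡ tutte (brokenWheel n) y x
proposition4 (suc k) _ x y = begin
  tutte (brokenWheel (suc k)) x y
    ≡⟨ BrokenWheel.tutte-brokenWheel x y k ⟩
  linearRecurrence (x + y + 1ℤ) (x * y) 1ℤ (x + y) (suc k)
    ≡⟨ cong₂ (λ s p → linearRecurrence (s + 1ℤ) p 1ℤ s (suc k)) (+-comm x y) (*-comm x y) ⟩
  linearRecurrence (y + x + 1ℤ) (y * x) 1ℤ (y + x) (suc k)
    ≡⟨ sym (BrokenWheel.tutte-brokenWheel y x k) ⟩
  tutte (brokenWheel (suc k)) y x ∎
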